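{- Let $(N,s,t,c)$ be a flow network containing the following subgraph (gadget) for an integer $\gamma\ge 3$ and two vertices $x,y$: new vertices $v_1,\dots,v_{2\gamma-4}$ (distinct from $s,t$); arcs $v_iv_{i+1}$ for $i\in[1,2\gamma-5]$, of capacity $1$ if $i$ is odd and $2$ if $i$ is even; an arc $xv_1$ of capacity $2$; for each even $i\in[2,2\gamma-4]$ an arc $xv_i$ of capacity $1$; for each odd $i\in[1,2\gamma-5]$ an arc $v_iy$ of capacity $1$; and an arc $v_{2\gamma-4}y$ of capacity $2$. Suppose that the vertices $v_i$ are incident to no other arcs of $N$ (only $x$ and $y$ are adjacent to vertices outside the gadget). Then for every all-or-nothing flow in $N$, either every arc of the gadget has flow $0$, or every arc of the gadget has flow equal to its capacity.
   Context: A flow network $(G,s,t,c)$ consists of a directed graph $G$, vertices $s,t$ and positive integer capacities $c$. A flow is $f:E\to\mathbb{N}$ with $0\le f(e)\le c(e)$ and flow conservation (inflow equals outflow) at every vertex other than $s,t$. It is all-or-nothing if $f(e)\in\{0,c(e)\}$ for all arcs $e$. -}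

module Defs where

open import Data.Nat using (ℕ; zero; suc; _+_; _*_; _∸_; _≤_; _<_; _%_)
open import Data.Fin using (Fin)
open import Data.Fin.Properties using (_≟_)
open import Data.List using (List; map; allFin)
open import Data.Nat.ListAction using (sum)
open import Data.Bool using (if_then_else_)
open import Data.Product using (Σ; _×_; ∃; ∃-syntax)
open import Data.Sum using (_⊎_)
open import Relation.Nullary using (¬_)
open import Relation.Nullary.Decidable using (⌊_⌋)
open import Relation.Binary.PropositionalEquality using (_≡_)

record FlowNetwork : Set where
  field
    n m   : ℕ
    tail  : Fin m → Fin n
    head  : Fin m → Fin n
    s t   : Fin n
    cap   : Fin m → ℕ
    cap>0 : ∀ e → 0 < cap e

module _ (N : FlowNetwork) where
  open FlowNetwork N

  inflow : (Fin m → ℕ) → Fin n → ℕ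
  inflow f v = sum (map (λ e → if ⌊ head e ≟ v ⌋ then f e else 0) (allFin m))

  outflow : (Fin m → ℕ) → Fin n → ℕ
  outflow f v = sum (map (λ e → if ⌊ tail e ≟ v ⌋ then f e else 0) (allFin m))

  record IsFlow (f : Fin m → ℕ) : Set where
    field
      capacity     : ∀ e → f e ≤ cap e
      conservation : ∀ v → ¬ v ≡ s → ¬ v ≡ t → inflow f v ≡ outflow f v

  AllOrNothing : (Fin m → ℕ) → Set
  AllOrNothing f = ∀ e → f e ≡ 0 ⊎ f e ≡ cap e

-- The arcs of the gadget with parameter γ (vertices v₁ … v_{2γ-4}, 1-indexed).
data GArc (γ : ℕ) : Set where
  pathArc : (i : ℕ) → 1 ≤ i → i ≤ 2 * γ ∸ 5 → GArc γ
  xFirst  : GArc γ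
  xEven   : (i : ℕ) → 2 ≤ i → i ≤ 2 * γ ∸ 4 → i % 2 ≡ 0 → GArc γ
  oddY    : (i : ℕ) → 1 ≤ i → i ≤ 2 * γ ∸ 5 → i % 2 ≡ 1 → GArc γ
  lastY   : GArc γ

gCap : ∀ {γ} → GArc γ → ℕ
gCap (pathArc i _ _) = if ⌊ Data.Nat._≟_ (i % 2) 1 ⌋ then 1 else 2
gCap xFirst          = 2
gCap (xEven _ _ _ _) = 1
gCap (oddY _ _ _ _)  = 1
gCap lastY           = 2

module _ {V : Set} (γ : ℕ) (x y : V) (v : ℕ → V) where
  gTail : GArc γ → V
  gTail (pathArc i _ _) = v i
  gTail xFirst          = x
  gTail (xEven _ _ _ _) = x
  gTail (oddY i _ _ _)  = v i
  gTail lastY           = v (2 * γ ∸ 4)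

  gHead : GArc γ → V
  gHead (pathArc i _ _) = v (suc i)
  gHead xFirst          = v 1
  gHead (xEven i _ _ _) = v i
  gHead (oddY _ _ _ _)  = y
  gHead lastY           = y

record Gadget (N : FlowNetwork) (γ : ℕ) (x y : Fin (FlowNetwork.n N))
              (v : ℕ → Fin (FlowNetwork.n N))
              (arc : GArc γ → Fin (FlowNetwork.m N)) : Set where
  open FlowNetwork N
  field
    γ≥3      : 3 ≤ γ
    v-inj    : ∀ i j → 1 ≤ i → i ≤ 2 * γ ∸ 4 → 1 ≤ j → j ≤ 2 * γ ∸ 4 →
               v i ≡ v j → i ≡ j
    v≢s      : ∀ i → 1 ≤ i → i ≤ 2 * γ ∸ 4 → ¬ v i ≡ s
    v≢t      : ∀ i → 1 ≤ i → i ≤ 2 * γ ∸ 4 → ¬ v i ≡ t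
    v≢x      : ∀ i → 1 ≤ i → i ≤ 2 * γ ∸ 4 → ¬ v i ≡ x
    v≢y      : ∀ i → 1 ≤ i → i ≤ 2 * γ ∸ 4 → ¬ v i ≡ y
    arc-tail : ∀ a → tail (arc a) ≡ gTail γ x y v a
    arc-head : ∀ a → head (arc a) ≡ gHead γ x y v a
    arc-cap  : ∀ a → cap (arc a) ≡ gCap a
    isolated : ∀ e i → 1 ≤ i → i ≤ 2 * γ ∸ 4 →
               (tail e ≡ v i ⊎ head e ≡ v i) → ∃[ a ] e ≡ arc a

{-# OPTIONS --safe #-}
-- Record for each gadget arc whether it is empty or saturated.  Each v_i meets exactly three
-- gadget arcs: one of capacity 2 on one side and two of capacity 1 on the other (odd v_i
-- receive 2 and emit 1 + 1, even v_i receive 1 + 1 and emit 2).  Under all-or-nothing,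
-- conservation at v_i reads 2[a] = [b] + [c] for Booleans [a], [b], [c], which forces all three
-- to agree.  Consecutive vertices share the path arc v_i v_{i+1}, so every gadget arc agrees
-- with x v_1.
module Submission where

open import Data.Bool using (Bool; true; false; if_then_else_)
open import Data.Fin using (Fin; zero; suc)
open import Data.Fin.Properties using (_≟_; suc-injective)
open import Data.List using (map; allFin; tabulate)
open import Data.List.Properties using (map-tabulate)
open import Data.Nat using (ℕ; zero; suc; _+_; _*_; _∸_; _≤_; _<_; _%_; z≤n; s≤s)
open import Data.Nat.DivMod using (m*n%n≡0)
open import Data.Nat.ListAction using (sum)
open import Data.Nat.Properties
  using ( ≤-irrelevant; ≡-irrelevant; +-identityʳ; +-comm; *-comm
        ; ≤-refl; ≤-pred; <⇒≤; ≤∧≢⇒<; m≤n⇒m<n∨m≡n; 1+n≰n)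
open import Data.Product using (∃-syntax; _×_; _,_; -,_; proj₁; proj₂)
open import Data.Unit using (⊤)
open import Data.Sum using (_⊎_; inj₁; inj₂; [_,_]′; swap)
open import Function using (_∘_; id)
open import Relation.Nullary using (¬_; yes; no; contradiction)
open import Relation.Nullary.Decidable using (⌊_⌋)
open import Relation.Binary.PropositionalEquality
  using (_≡_; _≢_; refl; sym; trans; cong; cong₂; subst; module ≡-Reasoning)

open import Defs

open ≡-Reasoning

scale : Bool → ℕ → ℕ
scale b c = if b then c else 0

allOrNothing-scale : ∀ {k c} → k ≡ 0 ⊎ k ≡ c → ∃[ b ] k ≡ scale b c
allOrNothing-scale (inj₁ k≡0) = false , k≡0
allOrNothing-scale (inj₂ k≡c) = true , k≡c

scale-split : ∀ {a b c} → scale a 2 ≡ scale b 1 + scale c 1 → b ≡ a × c ≡ a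
scale-split {false} {false} {false} _ = refl , refl
scale-split {true}  {true}  {true}  _ = refl , refl
scale-split {false} {true}          ()
scale-split {false} {false} {true}  ()
scale-split {true}  {false} {false} ()
scale-split {true}  {false} {true}  ()
scale-split {true}  {true}  {false} ()

scale-cases : ∀ {A : Set} {g c : A → ℕ} b → (∀ a → g a ≡ scale b (c a)) →
              (∀ a → g a ≡ 0) ⊎ (∀ a → g a ≡ c a)
scale-cases false g≡0 = inj₁ g≡0
scale-cases true  g≡c = inj₂ g≡c

sum-tabulate-zero : ∀ {m} (h : Fin m → ℕ) → (∀ e → h e ≡ 0) → sum (tabulate h) ≡ 0
sum-tabulate-zero {zero}  h h≡0 = refl
sum-tabulate-zero {suc m} h h≡0 = cong₂ _+_ (h≡0 zero) (sum-tabulate-zero (h ∘ suc) (h≡0 ∘ suc))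

sum-tabulate-one : ∀ {m} (h : Fin m → ℕ) e₀ → (∀ e → e ≢ e₀ → h e ≡ 0) → sum (tabulate h) ≡ h e₀
sum-tabulate-one h zero off = begin
  h zero + sum (tabulate (h ∘ suc))
    ≡⟨ cong (h zero +_) (sum-tabulate-zero (h ∘ suc) (λ e → off (suc e) λ ())) ⟩
  h zero + 0
    ≡⟨ +-identityʳ (h zero) ⟩
  h zero ∎
sum-tabulate-one h (suc e₀) off =
  cong₂ _+_ (off zero λ ()) (sum-tabulate-one (h ∘ suc) e₀ (λ e e≢e₀ → off (suc e) (e≢e₀ ∘ suc-injective)))

sum-tabulate-two : ∀ {m} (h : Fin m → ℕ) {e₀ e₁} → e₀ ≢ e₁ → (∀ e → e ≢ e₀ → e ≢ e₁ → h e ≡ 0) →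
                   sum (tabulate h) ≡ h e₀ + h e₁
sum-tabulate-two h {zero} {zero} e₀≢e₁ off = contradiction refl e₀≢e₁
sum-tabulate-two h {zero} {suc e₁} e₀≢e₁ off =
  cong (h zero +_) (sum-tabulate-one (h ∘ suc) e₁ (λ e e≢e₁ → off (suc e) (λ ()) (e≢e₁ ∘ suc-injective)))
sum-tabulate-two h {suc e₀} {zero} e₀≢e₁ off =
  trans (cong (h zero +_)
               (sum-tabulate-one (h ∘ suc) e₀ (λ e e≢e₀ → off (suc e) (e≢e₀ ∘ suc-injective) (λ ()))))
        (+-comm (h zero) (h (suc e₀)))
sum-tabulate-two h {suc e₀} {suc e₁} e₀≢e₁ off =
  cong₂ _+_ (off zero (λ ()) (λ ()))
            (sum-tabulate-two (h ∘ suc) (e₀≢e₁ ∘ cong suc)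
              (λ e e≢e₀ e≢e₁ → off (suc e) (e≢e₀ ∘ suc-injective) (e≢e₁ ∘ suc-injective)))

module _ (N : FlowNetwork) where
  open FlowNetwork N

  -- inflow N and outflow N are incidentSum head and incidentSum tail, definitionally.
  incidentSum : (Fin m → Fin n) → (Fin m → ℕ) → Fin n → ℕ
  incidentSum end f w = sum (map (λ e → if ⌊ end e ≟ w ⌋ then f e else 0) (allFin m))

  module _ (end : Fin m → Fin n) (f : Fin m → ℕ) (w : Fin n) where
    private
      selected : Fin m → ℕ
      selected e = if ⌊ end e ≟ w ⌋ then f e else 0

      selected-at : ∀ {e} → end e ≡ w → selected e ≡ f e
      selected-at {e} at with end e ≟ w
      ... | yes _  = refl
      ... | no ¬at = contradiction at ¬at

      selected-off : ∀ {e} → end e ≢ w → selected e ≡ 0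
      selected-off {e} ¬at with end e ≟ w
      ... | yes at = contradiction at ¬at
      ... | no _   = refl

      incidentSum-tabulate : incidentSum end f w ≡ sum (tabulate selected)
      incidentSum-tabulate = cong sum (map-tabulate id selected)

    incidentSum-one : ∀ {e₀} → end e₀ ≡ w → (∀ e → end e ≡ w → e ≡ e₀) → incidentSum end f w ≡ f e₀
    incidentSum-one {e₀} at₀ only = begin
      incidentSum end f w     ≡⟨ incidentSum-tabulate ⟩
      sum (tabulate selected) ≡⟨ sum-tabulate-one selected e₀ (λ e e≢e₀ → selected-off (e≢e₀ ∘ only e)) ⟩
      selected e₀             ≡⟨ selected-at at₀ ⟩
      f e₀                    ∎

    incidentSum-two : ∀ {e₀ e₁} → e₀ ≢ e₁ → end e₀ ≡ w → end e₁ ≡ w →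
                      (∀ e → end e ≡ w → e ≡ e₀ ⊎ e ≡ e₁) → incidentSum end f w ≡ f e₀ + f e₁
    incidentSum-two {e₀} {e₁} e₀≢e₁ at₀ at₁ only = begin
      incidentSum end f w       ≡⟨ incidentSum-tabulate ⟩
      sum (tabulate selected)   ≡⟨ sum-tabulate-two selected e₀≢e₁ off ⟩
      selected e₀ + selected e₁ ≡⟨ cong₂ _+_ (selected-at at₀) (selected-at at₁) ⟩
      f e₀ + f e₁               ∎
      where
      off : ∀ e → e ≢ e₀ → e ≢ e₁ → selected e ≡ 0
      off e e≢e₀ e≢e₁ = selected-off (λ at → [ e≢e₀ , e≢e₁ ]′ (only e at))

¬even∧odd : ∀ i → i % 2 ≡ 0 → ¬ i % 2 ≡ 1
¬even∧odd _ i-even i-odd with () ← trans (sym i-even) i-odd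

-- (2 + i) % 2 reduces to i % 2, so parity facts follow by plain recursion.
parity : ∀ i → i % 2 ≡ 0 ⊎ i % 2 ≡ 1
parity zero          = inj₁ refl
parity (suc zero)    = inj₂ refl
parity (suc (suc i)) = parity i

even⇒suc-odd : ∀ i → i % 2 ≡ 0 → suc i % 2 ≡ 1
even⇒suc-odd zero          _      = refl
even⇒suc-odd (suc zero)    ()
even⇒suc-odd (suc (suc i)) i-even = even⇒suc-odd i i-even

odd⇒suc-even : ∀ i → i % 2 ≡ 1 → suc i % 2 ≡ 0
odd⇒suc-even zero          ()
odd⇒suc-even (suc zero)    _     = refl
odd⇒suc-even (suc (suc i)) i-odd = odd⇒suc-even i i-odd

gadget-size-suc : ∀ {γ} → 3 ≤ γ → 2 * γ ∸ 4 ≡ suc (2 * γ ∸ 5)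
gadget-size-suc {γ} (s≤s (s≤s (s≤s _))) =
  trans (cong (_∸ 4) (*-comm 2 γ)) (cong (λ k → suc (k ∸ 5)) (*-comm γ 2))

gadget-size-even : ∀ {γ} → 3 ≤ γ → (2 * γ ∸ 4) % 2 ≡ 0
gadget-size-even {γ} (s≤s (s≤s (s≤s {n = g} _))) =
  trans (cong (λ k → (k ∸ 4) % 2) (*-comm 2 γ)) (m*n%n≡0 (suc g) 2)

pathArc-irrelevant : ∀ {γ i p p′ q q′} → pathArc {γ} i p q ≡ pathArc i p′ q′
pathArc-irrelevant {p = p} {p′} {q} {q′} = cong₂ (pathArc _) (≤-irrelevant p p′) (≤-irrelevant q q′)

xEven-irrelevant : ∀ {γ i p p′ q q′ r r′} → xEven {γ} i p q r ≡ xEven i p′ q′ r′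
xEven-irrelevant {p = p} {p′} {q} {q′} {r} {r′}
  rewrite ≤-irrelevant p p′ | ≤-irrelevant q q′ | ≡-irrelevant r r′ = refl

oddY-irrelevant : ∀ {γ i p p′ q q′ r r′} → oddY {γ} i p q r ≡ oddY i p′ q′ r′
oddY-irrelevant {p = p} {p′} {q} {q′} {r} {r′}
  rewrite ≤-irrelevant p p′ | ≤-irrelevant q q′ | ≡-irrelevant r r′ = refl

module _ {A B : Set} (φ : A → B) (γ : ℕ) (x y : A) (v : ℕ → A) where
  gTail-natural : ∀ a → gTail γ (φ x) (φ y) (φ ∘ v) a ≡ φ (gTail γ x y v a)
  gTail-natural (pathArc _ _ _) = refl
  gTail-natural xFirst          = refl
  gTail-natural (xEven _ _ _ _) = refl
  gTail-natural (oddY _ _ _ _)  = refl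
  gTail-natural lastY           = refl

  gHead-natural : ∀ a → gHead γ (φ x) (φ y) (φ ∘ v) a ≡ φ (gHead γ x y v a)
  gHead-natural (pathArc _ _ _) = refl
  gHead-natural xFirst          = refl
  gHead-natural (xEven _ _ _ _) = refl
  gHead-natural (oddY _ _ _ _)  = refl
  gHead-natural lastY           = refl

-- Symbolic endpoints: instantiating gTail/gHead at Vertex turns questions about endpoints
-- into pattern matching on constructors.
data Vertex : Set where
  X Y : Vertex
  V   : ℕ → Vertex

module GadgetFlow {N : FlowNetwork} {γ : ℕ} {x y : Fin (FlowNetwork.n N)} {v : ℕ → Fin (FlowNetwork.n N)}
                  {arc : GArc γ → Fin (FlowNetwork.m N)} (G : Gadget N γ x y v arc)
                  {f : Fin (FlowNetwork.m N) → ℕ} (F : IsFlow N f) (A : AllOrNothing N f) where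
  open FlowNetwork N
  open Gadget G
  open IsFlow F

  K L : ℕ
  K = 2 * γ ∸ 4
  L = 2 * γ ∸ 5

  K≡1+L : K ≡ suc L
  K≡1+L = gadget-size-suc γ≥3

  K-even : K % 2 ≡ 0
  K-even = gadget-size-even γ≥3

  <K⇒≤L : ∀ {i} → i < K → i ≤ L
  <K⇒≤L {i} i<K = ≤-pred (subst (suc i ≤_) K≡1+L i<K)

  ≤L⇒<K : ∀ {i} → i ≤ L → i < K
  ≤L⇒<K {i} i≤L = subst (suc i ≤_) (sym K≡1+L) (s≤s i≤L)

  ≤L⇒≤K : ∀ {i} → i ≤ L → i ≤ K
  ≤L⇒≤K = <⇒≤ ∘ ≤L⇒<K

  K≰L : ¬ K ≤ L
  K≰L K≤L = 1+n≰n (subst (_≤ L) K≡1+L K≤L)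

  odd⇒≤L : ∀ {i} → i % 2 ≡ 1 → i ≤ K → i ≤ L
  odd⇒≤L i-odd i≤K = <K⇒≤L (≤∧≢⇒< i≤K λ { refl → ¬even∧odd K K-even i-odd })

  pathArc-cap-odd : ∀ {i} (p : 1 ≤ i) (q : i ≤ L) → i % 2 ≡ 1 → gCap (pathArc {γ} i p q) ≡ 1
  pathArc-cap-odd _ _ i-odd rewrite i-odd = refl

  pathArc-cap-even : ∀ {i} (p : 1 ≤ i) (q : i ≤ L) → i % 2 ≡ 0 → gCap (pathArc {γ} i p q) ≡ 2
  pathArc-cap-even _ _ i-even rewrite i-even = refl

  src dst : GArc γ → Vertex
  src = gTail γ X Y V
  dst = gHead γ X Y V

  Touches : GArc γ → ℕ → Set
  Touches a i = src a ≡ V i ⊎ dst a ≡ V i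

  realise : Vertex → Fin n
  realise X     = x
  realise Y     = y
  realise (V i) = v i

  Bounded : Vertex → Set
  Bounded (V i) = 1 ≤ i × i ≤ K
  Bounded _     = ⊤

  src-bounded : ∀ a → Bounded (src a)
  src-bounded (pathArc _ p q)   = p , ≤L⇒≤K q
  src-bounded xFirst            = _
  src-bounded (xEven _ _ _ _)   = _
  src-bounded (oddY _ p q _)    = p , ≤L⇒≤K q
  src-bounded lastY             = ≤L⇒<K z≤n , ≤-refl

  dst-bounded : ∀ a → Bounded (dst a)
  dst-bounded (pathArc _ _ q)   = s≤s z≤n , ≤L⇒<K q
  dst-bounded xFirst            = s≤s z≤n , ≤L⇒<K z≤n
  dst-bounded (xEven _ p q _)   = <⇒≤ p , q
  dst-bounded (oddY _ _ _ _)    = _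
  dst-bounded lastY             = _

  realise-pinned : ∀ {i} w → Bounded w → 1 ≤ i → i ≤ K → realise w ≡ v i → w ≡ V i
  realise-pinned X     _         p q x≡v = contradiction (sym x≡v) (v≢x _ p q)
  realise-pinned Y     _         p q y≡v = contradiction (sym y≡v) (v≢y _ p q)
  realise-pinned (V j) (p′ , q′) p q eq  = cong V (v-inj j _ p′ q′ p q eq)

  tail-realise : ∀ a → tail (arc a) ≡ realise (src a)
  tail-realise a = trans (arc-tail a) (gTail-natural realise γ X Y V a)

  head-realise : ∀ a → head (arc a) ≡ realise (dst a)
  head-realise a = trans (arc-head a) (gHead-natural realise γ X Y V a)

  leaving : ∀ {i} → 1 ≤ i → i ≤ K → (P : Fin m → Set) → (∀ a → src a ≡ V i → P (arc a)) →
            ∀ e → tail e ≡ v i → P e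
  leaving p q P P-arc e e-at with isolated e _ p q (inj₁ e-at)
  ... | a , refl =
    P-arc a (realise-pinned (src a) (src-bounded a) p q (trans (sym (tail-realise a)) e-at))

  entering : ∀ {i} → 1 ≤ i → i ≤ K → (P : Fin m → Set) → (∀ a → dst a ≡ V i → P (arc a)) →
             ∀ e → head e ≡ v i → P e
  entering p q P P-arc e e-at with isolated e _ p q (inj₂ e-at)
  ... | a , refl =
    P-arc a (realise-pinned (dst a) (dst-bounded a) p q (trans (sym (head-realise a)) e-at))

  conserved : ∀ {i} → 1 ≤ i → i ≤ K → inflow N f (v i) ≡ outflow N f (v i)
  conserved p q = conservation _ (v≢s _ p q) (v≢t _ p q)

  full : Fin m → Bool
  full e = proj₁ (allOrNothing-scale (A e))

  f≡scale-full : ∀ a → f (arc a) ≡ scale (full (arc a)) (gCap a)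
  f≡scale-full a =
    trans (proj₂ (allOrNothing-scale (A (arc a)))) (cong (scale (full (arc a))) (arc-cap a))

  fork-fullness : ∀ a₀ a₁ a₂ → gCap a₀ ≡ 2 → gCap a₁ ≡ 1 → gCap a₂ ≡ 1 →
                  f (arc a₀) ≡ f (arc a₁) + f (arc a₂) →
                  full (arc a₁) ≡ full (arc a₀) × full (arc a₂) ≡ full (arc a₀)
  fork-fullness a₀ a₁ a₂ c₀ c₁ c₂ balance = scale-split (begin
    scale (full (arc a₀)) 2                           ≡⟨ cong (scale (full (arc a₀))) c₀ ⟨
    scale (full (arc a₀)) (gCap a₀)                   ≡⟨ f≡scale-full a₀ ⟨
    f (arc a₀)                                        ≡⟨ balance ⟩
    f (arc a₁) + f (arc a₂)                           ≡⟨ cong₂ _+_ (f≡scale-full a₁) (f≡scale-full a₂) ⟩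
    scale (full (arc a₁)) (gCap a₁) + scale (full (arc a₂)) (gCap a₂)
      ≡⟨ cong₂ (λ c c′ → scale (full (arc a₁)) c + scale (full (arc a₂)) c′) c₁ c₂ ⟩
    scale (full (arc a₁)) 1 + scale (full (arc a₂)) 1 ∎)

  incident-full : ∀ {P Q : GArc γ → Set} {e₀ e₁ e₂} → full e₁ ≡ full e₀ → full e₂ ≡ full e₀ →
                  (∀ a → P a → arc a ≡ e₀) → (∀ a → Q a → arc a ≡ e₁ ⊎ arc a ≡ e₂) →
                  ∀ a → P a ⊎ Q a → full (arc a) ≡ full e₀
  incident-full _  _  one _   a (inj₁ Pa) = cong full (one a Pa)
  incident-full s₁ s₂ _   two a (inj₂ Qa) with two a Qa
  ... | inj₁ a≡e₁ = trans (cong full a≡e₁) s₁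
  ... | inj₂ a≡e₂ = trans (cong full a≡e₂) s₂

  into-v₁ : ∀ a → dst a ≡ V 1 → arc a ≡ arc xFirst
  into-v₁ (pathArc _ () _)       refl
  into-v₁ xFirst                 refl = refl
  into-v₁ (xEven _ (s≤s ()) _ _) refl
  into-v₁ (oddY _ _ _ _)         ()
  into-v₁ lastY                  ()

  into-odd : ∀ {j} (q : suc j ≤ L) → suc (suc j) % 2 ≡ 1 →
             ∀ a → dst a ≡ V (suc (suc j)) → arc a ≡ arc (pathArc (suc j) (s≤s z≤n) q)
  into-odd q i-odd (pathArc _ _ _)      refl = cong arc pathArc-irrelevant
  into-odd q i-odd xFirst               ()
  into-odd q i-odd (xEven i _ _ i-even) refl = contradiction i-odd (¬even∧odd i i-even)
  into-odd q i-odd (oddY _ _ _ _)       ()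
  into-odd q i-odd lastY                ()

  out-of-odd : ∀ {i} (p : 1 ≤ i) (q : i ≤ L) (i-odd : i % 2 ≡ 1) →
               ∀ a → src a ≡ V i → arc a ≡ arc (pathArc i p q) ⊎ arc a ≡ arc (oddY i p q i-odd)
  out-of-odd p q i-odd (pathArc _ _ _) refl = inj₁ (cong arc pathArc-irrelevant)
  out-of-odd p q i-odd xFirst          ()
  out-of-odd p q i-odd (xEven _ _ _ _) ()
  out-of-odd p q i-odd (oddY _ _ _ _)  refl = inj₂ (cong arc oddY-irrelevant)
  out-of-odd p q i-odd lastY           refl = contradiction i-odd (¬even∧odd K K-even)

  into-even : ∀ {j} (q : suc (suc j) ≤ K) (i-even : suc (suc j) % 2 ≡ 0) →
              ∀ a → dst a ≡ V (suc (suc j)) →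
              arc a ≡ arc (pathArc (suc j) (s≤s z≤n) (<K⇒≤L q))
              ⊎ arc a ≡ arc (xEven (suc (suc j)) (s≤s (s≤s z≤n)) q i-even)
  into-even q i-even (pathArc _ _ _) refl = inj₁ (cong arc pathArc-irrelevant)
  into-even q i-even xFirst          ()
  into-even q i-even (xEven _ _ _ _) refl = inj₂ (cong arc xEven-irrelevant)
  into-even q i-even (oddY _ _ _ _)  ()
  into-even q i-even lastY           ()

  out-of-even : ∀ {i} (p : 1 ≤ i) (q : i ≤ L) → i % 2 ≡ 0 →
                ∀ a → src a ≡ V i → arc a ≡ arc (pathArc i p q)
  out-of-even p q i-even (pathArc _ _ _)     refl = cong arc pathArc-irrelevant
  out-of-even p q i-even xFirst              ()
  out-of-even p q i-even (xEven _ _ _ _)     ()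
  out-of-even p q i-even (oddY i _ _ i-odd)  refl = contradiction i-odd (¬even∧odd i i-even)
  out-of-even p q i-even lastY               refl = contradiction q K≰L

  out-of-last : ∀ a → src a ≡ V K → arc a ≡ arc lastY
  out-of-last (pathArc _ _ q) refl = contradiction q K≰L
  out-of-last xFirst          ()
  out-of-last (xEven _ _ _ _) ()
  out-of-last (oddY _ _ q _)  refl = contradiction q K≰L
  out-of-last lastY           refl = refl

  odd-vertex-fullness : ∀ {i} (p : 1 ≤ i) (q : i ≤ K) → i % 2 ≡ 1 → ∀ a₀ → gCap a₀ ≡ 2 → dst a₀ ≡ V i →
            (∀ a → dst a ≡ V i → arc a ≡ arc a₀) → ∀ a → Touches a i → full (arc a) ≡ full (arc a₀)
  odd-vertex-fullness {i} p q i-odd a₀ c₀ dst₀ into a touches =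
    incident-full (proj₁ shares) (proj₂ shares) into (out-of-odd p q′ i-odd) a (swap touches)
    where
    q′ : i ≤ L
    q′ = odd⇒≤L i-odd q
    a₁ a₂ : GArc γ
    a₁ = pathArc i p q′
    a₂ = oddY i p q′ i-odd

    apart : arc a₁ ≢ arc a₂
    apart a₁≡a₂ = v≢y (suc i) (s≤s z≤n) (≤L⇒<K q′) (begin
      v (suc i)      ≡⟨ head-realise a₁ ⟨
      head (arc a₁)  ≡⟨ cong head a₁≡a₂ ⟩
      head (arc a₂)  ≡⟨ head-realise a₂ ⟩
      y              ∎)

    balance : f (arc a₀) ≡ f (arc a₁) + f (arc a₂)
    balance = begin
      f (arc a₀)
        ≡⟨ incidentSum-one N head f (v i) (trans (head-realise a₀) (cong realise dst₀)) (entering p q _ into) ⟨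
      inflow N f (v i)
        ≡⟨ conserved p q ⟩
      outflow N f (v i)
        ≡⟨ incidentSum-two N tail f (v i) apart (tail-realise a₁) (tail-realise a₂)
                           (leaving p q _ (out-of-odd p q′ i-odd)) ⟩
      f (arc a₁) + f (arc a₂) ∎

    shares : full (arc a₁) ≡ full (arc a₀) × full (arc a₂) ≡ full (arc a₀)
    shares = fork-fullness a₀ a₁ a₂ c₀ (pathArc-cap-odd p q′ i-odd) refl balance

  even-vertex-fullness : ∀ {j} (q : suc (suc j) ≤ K) (i-even : suc (suc j) % 2 ≡ 0) → ∀ a₀ → gCap a₀ ≡ 2 →
             src a₀ ≡ V (suc (suc j)) → (∀ a → src a ≡ V (suc (suc j)) → arc a ≡ arc a₀) →
             ∀ a → Touches a (suc (suc j)) → full (arc a) ≡ full (arc a₀)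
  even-vertex-fullness {j} q i-even a₀ c₀ src₀ out a =
    incident-full (proj₁ shares) (proj₂ shares) out (into-even q i-even) a
    where
    i : ℕ
    i = suc (suc j)
    p : 1 ≤ i
    p = s≤s z≤n
    a₁ a₂ : GArc γ
    a₁ = pathArc (suc j) (s≤s z≤n) (<K⇒≤L q)
    a₂ = xEven i (s≤s (s≤s z≤n)) q i-even

    apart : arc a₁ ≢ arc a₂
    apart a₁≡a₂ = v≢x (suc j) (s≤s z≤n) (<⇒≤ q) (begin
      v (suc j)      ≡⟨ tail-realise a₁ ⟨
      tail (arc a₁)  ≡⟨ cong tail a₁≡a₂ ⟩
      tail (arc a₂)  ≡⟨ tail-realise a₂ ⟩
      x              ∎)

    balance : f (arc a₀) ≡ f (arc a₁) + f (arc a₂)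
    balance = begin
      f (arc a₀)
        ≡⟨ incidentSum-one N tail f (v i) (trans (tail-realise a₀) (cong realise src₀)) (leaving p q _ out) ⟨
      outflow N f (v i)
        ≡⟨ conserved p q ⟨
      inflow N f (v i)
        ≡⟨ incidentSum-two N head f (v i) apart (head-realise a₁) (head-realise a₂)
                           (entering p q _ (into-even q i-even)) ⟩
      f (arc a₁) + f (arc a₂) ∎

    shares : full (arc a₁) ≡ full (arc a₀) × full (arc a₂) ≡ full (arc a₀)
    shares = fork-fullness a₀ a₁ a₂ c₀ (pathArc-cap-odd (s≤s z≤n) (<K⇒≤L q) (even⇒suc-odd j i-even))
                           refl balance

  vertex-fullness : ∀ i → 1 ≤ i → i ≤ K → ∃[ b ] ∀ a → Touches a i → full (arc a) ≡ b
  vertex-fullness (suc i) p q with parity (suc i)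
  vertex-fullness 1 p q             | inj₂ _     =
    -, odd-vertex-fullness p q refl xFirst refl refl into-v₁
  vertex-fullness (suc (suc j)) p q | inj₂ i-odd =
    -, odd-vertex-fullness p q i-odd (pathArc (suc j) (s≤s z≤n) (<K⇒≤L q))
         (pathArc-cap-even (s≤s z≤n) (<K⇒≤L q) (odd⇒suc-even j i-odd)) refl (into-odd (<K⇒≤L q) i-odd)
  vertex-fullness 1 p q             | inj₁ ()
  vertex-fullness (suc (suc j)) p q | inj₁ i-even with m≤n⇒m<n∨m≡n q
  ... | inj₁ i<K =
    -, even-vertex-fullness q i-even (pathArc (suc (suc j)) p (<K⇒≤L i<K))
         (pathArc-cap-even p (<K⇒≤L i<K) i-even) refl (out-of-even p (<K⇒≤L i<K) i-even)
  ... | inj₂ i≡K =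
    -, even-vertex-fullness q i-even lastY refl (cong V (sym i≡K))
         (λ a src≡ → out-of-last a (trans src≡ (cong V i≡K)))

  touching-same-fullness : ∀ {i} → 1 ≤ i → i ≤ K → ∀ a b → Touches a i → Touches b i →
                           full (arc a) ≡ full (arc b)
  touching-same-fullness p q a b a-at b-at with vertex-fullness _ p q
  ... | _ , hub = trans (hub a a-at) (sym (hub b b-at))

  touching-fullness : ∀ i → 1 ≤ i → i ≤ K → ∀ a → Touches a i → full (arc a) ≡ full (arc xFirst)
  touching-fullness 1             p q a a-at = touching-same-fullness p q a xFirst a-at (inj₂ refl)
  touching-fullness (suc (suc j)) p q a a-at = trans
    (touching-same-fullness p q a link a-at (inj₂ refl))
    (touching-fullness (suc j) (s≤s z≤n) (<⇒≤ q) link (inj₁ refl))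
    where
    link : GArc γ
    link = pathArc (suc j) (s≤s z≤n) (<K⇒≤L q)

  touches-some : ∀ a → ∃[ i ] 1 ≤ i × i ≤ K × Touches a i
  touches-some (pathArc i p q)  = i , p , ≤L⇒≤K q , inj₁ refl
  touches-some xFirst           = 1 , s≤s z≤n , ≤L⇒<K z≤n , inj₂ refl
  touches-some (xEven i p q _)  = i , <⇒≤ p , q , inj₂ refl
  touches-some (oddY i p q _)   = i , p , ≤L⇒≤K q , inj₁ refl
  touches-some lastY            = K , ≤L⇒<K z≤n , ≤-refl , inj₁ refl

  gadget-scale : ∀ a → f (arc a) ≡ scale (full (arc xFirst)) (gCap a)
  gadget-scale a with touches-some a
  ... | i , p , q , a-at =
    trans (f≡scale-full a) (cong (λ b → scale b (gCap a)) (touching-fullness i p q a a-at))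

mainTheorem8 : (N : FlowNetwork) (γ : ℕ) (x y : Fin (FlowNetwork.n N))
               (v : ℕ → Fin (FlowNetwork.n N))
               (arc : GArc γ → Fin (FlowNetwork.m N)) →
               Gadget N γ x y v arc →
               (f : Fin (FlowNetwork.m N) → ℕ) → IsFlow N f → AllOrNothing N f →
               (∀ a → f (arc a) ≡ 0) ⊎ (∀ a → f (arc a) ≡ gCap a)
mainTheorem8 N γ x y v arc G f F A = scale-cases (full (arc xFirst)) gadget-scale
  where open GadgetFlow G F A
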